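{- Two-counter machine halting many-one reduces to one-counter machine $1$-halting; that is, there is a computable function mapping each triple $(N,a,b)$, consisting of a two-counter machine $N$ and $a,b\in\mathbb{N}$, to a one-counter machine $M$ such that the configuration $(0,(a,b))$ terminates in $N$ if and only if the configuration $(0,1)$ terminates in $M$.
   Context: A two-counter machine $N$ is a finite list of instructions, indexed from $0$, each of shape $\mathrm{inc}_0$, $\mathrm{inc}_1$, $\mathrm{dec}_0(j)$ or $\mathrm{dec}_1(j)$ with $j\in\mathbb{N}$. Configurations are $(i,(a,b))$ with $i,a,b\in\mathbb{N}$. Step relation: if $\mathrm{inc}_0$ is at index $i$, $(i,(a,b))\to(i+1,(a+1,b))$; if $\mathrm{inc}_1$ is at index $i$, $(i,(a,b))\to(i+1,(a,b+1))$; if $\mathrm{dec}_0(j)$ is at index $i$, $(i,(0,b))\to(i+1,(0,b))$ and $(i,(a+1,b))\to(j,(a,b))$; if $\mathrm{dec}_1(j)$ is at index $i$, $(i,(a,0))\to(i+1,(a,0))$ and $(i,(a,b+1))\to(j,(a,b))$; otherwise (no instruction at index $i$) the configuration is halting. A configuration terminates in $N$ if it reaches a halting configuration in finitely many steps. A one-counter machine $M$ is a finite list of instructions $(j,d)$ with $j\in\mathbb{N}$, $d\in\{1,2,3,4\}$, indexed from $0$, with length $|M|$. Configurations are $(i,c)$ with $i\in\mathbb{N}$, $c\in\mathbb{N}$, $c>0$. Step: if $|M|\le i$ then $(i,c)\to(i,c)$ and $(i,c)$ is halting; if the instruction at index $i$ is $(j,d)$ and $d\mid c$ then $(i,c)\to(j,c\cdot\frac{d+1}{d})$;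 if $d\nmid c$ then $(i,c)\to(i+1,c)$. A configuration terminates in $M$ if it reaches a halting configuration in finitely many steps. A problem $P$ over domain $X$ many-one reduces to a problem $Q$ over domain $Y$ if there is a computable $f:X\to Y$ with $P(x)\iff Q(f(x))$ for all $x\in X$. -}

module Defs where

open import Data.Nat using (ℕ; zero; suc; _+_; _*_; _≤_)
open import Data.Nat.Divisibility using (_∣_; _∤_)
open import Data.Nat.DivMod using (_/_)
open import Data.Fin using (Fin; toℕ)
open import Data.List using (List; []; _∷_; length)
open import Data.Maybe using (Maybe; just; nothing)
open import Data.Product using (_×_; _,_; ∃)
open import Relation.Binary.PropositionalEquality using (_≡_)
open import Relation.Binary.Construct.Closure.ReflexiveTransitive using (Star)

_‼_ : {A : Set} → List A → ℕ → Maybe A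
[]       ‼ _       = nothing
(x ∷ xs) ‼ zero    = just x
(x ∷ xs) ‼ (suc i) = xs ‼ i

data Instr2 : Set where
  inc₀ : Instr2
  inc₁ : Instr2
  dec₀ : ℕ → Instr2
  dec₁ : ℕ → Instr2

Machine2 : Set
Machine2 = List Instr2

Config2 : Set
Config2 = ℕ × (ℕ × ℕ)

data Step2 (N : Machine2) : Config2 → Config2 → Set where
  s-inc₀  : ∀ {i a b}   → N ‼ i ≡ just inc₀     → Step2 N (i , (a , b)) (suc i , (suc a , b))
  s-inc₁  : ∀ {i a b}   → N ‼ i ≡ just inc₁     → Step2 N (i , (a , b)) (suc i , (a , suc b))
  s-dec₀z : ∀ {i j b}   → N ‼ i ≡ just (dec₀ j) → Step2 N (i , (0 , b)) (suc i , (0 , b))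
  s-dec₀s : ∀ {i j a b} → N ‼ i ≡ just (dec₀ j) → Step2 N (i , (suc a , b)) (j , (a , b))
  s-dec₁z : ∀ {i j a}   → N ‼ i ≡ just (dec₁ j) → Step2 N (i , (a , 0)) (suc i , (a , 0))
  s-dec₁s : ∀ {i j a b} → N ‼ i ≡ just (dec₁ j) → Step2 N (i , (a , suc b)) (j , (a , b))

Halting2 : Machine2 → Config2 → Set
Halting2 N (i , _) = N ‼ i ≡ nothing

Terminates2 : Machine2 → Config2 → Set
Terminates2 N x = ∃ λ y → Star (Step2 N) x y × Halting2 N y

-- An instruction (j , k) with k : Fin 4 stands for (j , d) with d = 1 + toℕ k ∈ {1,2,3,4}.
Instr1 : Set
Instr1 = ℕ × Fin 4

Machine1 : Set
Machine1 = List Instr1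

dval : Fin 4 → ℕ
dval k = suc (toℕ k)

-- (i , c); the counter c is meant to be positive.
Config1 : Set
Config1 = ℕ × ℕ

data Step1 (M : Machine1) : Config1 → Config1 → Set where
  s-halt : ∀ {i c}   → length M ≤ i → Step1 M (i , c) (i , c)
  s-div  : ∀ {i c j k} → M ‼ i ≡ just (j , k) → dval k ∣ c →
           Step1 M (i , c) (j , (c * (dval k + 1)) / dval k)
  s-ndiv : ∀ {i c j k} → M ‼ i ≡ just (j , k) → dval k ∤ c →
           Step1 M (i , c) (suc i , c)

Halting1 : Machine1 → Config1 → Set
Halting1 M (i , _) = length M ≤ i

Terminates1 : Machine1 → Config1 → Set
Terminates1 M x = ∃ λ y → Star (Step1 M) x y × Halting1 M y

-- The counters (a , b) are kept in one counter as 4 ^ a * 3 ^ b * 5 ^ g, where g merely counts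
-- the decrements performed so far.  Each instruction of N becomes a block of two instructions:
-- inc₀ multiplies by 2 twice; inc₁ multiplies by 2 and then by 3/2; dec₀ j multiplies by 5/4 and
-- jumps to block j if 4 divides the counter, and otherwise the counter is odd and falls through
-- both; dec₁ j multiplies by 4/3 if 3 divides the counter and then passes a detour instruction
-- that multiplies by 5/4 and jumps to block j.  The detours precede the blocks, and the start
-- counter 1 falls through all of them.  So every step of N is simulated by a non-empty run, and
-- as one-counter machines are deterministic, termination is reflected as well.  Arbitrary
-- initial counters are loaded by prefixing N with a copies of inc₀ and b copies of inc₁.
module Submission where

open import Defs
open import Data.Nat using (ℕ; zero; suc; _+_; _*_; _^_; _≤_; _<_; z≤n; s≤s)
open import Data.Nat.Properties
open import Data.Nat.Divisibility using (_∤_; _∣?_; divides; ∣-trans; ∣1⇒≡1)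
open import Data.Nat.DivMod using (_/_; m*n/n≡m)
open import Data.Nat.Primality using (Prime; prime?; euclidsLemma; ¬prime[1])
open import Data.Nat.Tactic.RingSolver using (solve-∀)
open import Data.Fin using (Fin) renaming (zero to fzero; suc to fsuc)
open import Data.List using (List; []; _∷_; length; map; _++_)
open import Data.List.Properties using (length-++; length-map)
open import Data.Maybe as Maybe using (just; nothing)
open import Data.Maybe.Properties using (just-injective; map-just; map-nothing)
open import Data.Product using (Σ; ∃; ∃₂; _×_; _,_; proj₁; proj₂)
open import Data.Sum using (_⊎_; inj₁; inj₂)
open import Data.Empty using (⊥; ⊥-elim)
open import Relation.Nullary.Decidable using (from-yes; from-no)
open import Level using (0ℓ)
open import Relation.Unary using (Pred)
open import Relation.Binary using (Rel; REL)
open import Relation.Binary.Rewriting using (Deterministic)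
open import Relation.Binary.PropositionalEquality
open import Relation.Binary.Construct.Closure.ReflexiveTransitive using (Star; ε; _◅_; _◅◅_)
open import Function.Bundles using (_⇔_; mk⇔)
open import Function.Properties.Equivalence using () renaming (refl to ⇔-refl; trans to ⇔-trans)

Terminates : {C : Set} → Rel C 0ℓ → Pred C 0ℓ → C → Set
Terminates _⟶_ Halted x = ∃ λ y → Star _⟶_ x y × Halted y

record Simulation {A B : Set} (_⇾_ : Rel A 0ℓ) (HaltedA : Pred A 0ℓ)
                  (_↦_ : Rel B 0ℓ) (HaltedB : Pred B 0ℓ) (_≈_ : REL A B 0ℓ) : Set where
  field
    deterministic    : Deterministic _≡_ _↦_
    halted-stays     : ∀ {b b′} → HaltedB b → b ↦ b′ → b′ ≡ b
    progress         : ∀ x → HaltedA x ⊎ ∃ (x ⇾_)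
    simulate         : ∀ {x y b} → x ⇾ y → x ≈ b →
                       ∃₂ λ b₁ b′ → b ↦ b₁ × Star _↦_ b₁ b′ × y ≈ b′
    halted-preserved : ∀ {x b} → x ≈ b → HaltedA x → HaltedB b
    halted-reflected : ∀ {x b} → x ≈ b → HaltedB b → HaltedA x

module _ {A B : Set} {_⇾_ : Rel A 0ℓ} {HaltedA : Pred A 0ℓ} {_↦_ : Rel B 0ℓ} {HaltedB : Pred B 0ℓ}
         {_≈_ : REL A B 0ℓ} (S : Simulation _⇾_ HaltedA _↦_ HaltedB _≈_) where
  open Simulation S

  halted-forever : ∀ {h b} → HaltedB h → Star _↦_ h b → b ≡ h
  halted-forever hh ε = refl
  halted-forever hh (s ◅ r) rewrite halted-stays hh s = halted-forever hh r

  termination-preserved : ∀ {x z b} → x ≈ b → Star _⇾_ x z → HaltedA z → Terminates _↦_ HaltedB b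
  termination-preserved x≈b ε hz = _ , ε , halted-preserved x≈b hz
  termination-preserved x≈b (s ◅ r) hz with simulate s x≈b
  ... | _ , _ , t , u , y≈b′ with termination-preserved y≈b′ r hz
  ... | h , v , hh = h , t ◅ u ◅◅ v , hh

  -- The invariant is that the run from w passes through the image b of x; determinism
  -- forces every simulating run starting at b to be a prefix of the run from w.
  termination-reflected : ∀ {w h x b} → Star _↦_ w h → HaltedB h → x ≈ b → Star _↦_ w b →
                          Terminates _⇾_ HaltedA x
  termination-reflected {x = x} ε hh x≈b u =
    _ , ε , halted-reflected (subst (x ≈_) (halted-forever hh u) x≈b) hh
  termination-reflected (s ◅ r) hh x≈b (s′ ◅ u) =
    termination-reflected r hh x≈b (subst (λ v → Star _↦_ v _) (deterministic s′ s) u)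
  termination-reflected {x = x} (s ◅ r) hh x≈b ε with progress x
  ... | inj₁ hx = _ , ε , hx
  ... | inj₂ (y , x⇾y) with simulate x⇾y x≈b
  ... | _ , _ , t , u , y≈b′
      with termination-reflected r hh y≈b′ (subst (λ v → Star _↦_ v _) (deterministic t s) u)
  ... | z , v , hz = z , x⇾y ◅ v , hz

  terminates⇔ : ∀ {x b w} → x ≈ b → Star _↦_ w b →
                Terminates _⇾_ HaltedA x ⇔ Terminates _↦_ HaltedB w
  terminates⇔ x≈b u = mk⇔
    (λ (z , r , hz) → let (h , v , hh) = termination-preserved x≈b r hz in h , u ◅◅ v , hh)
    (λ (h , r , hh) → termination-reflected r hh x≈b u)

module _ {A : Set} where

  ‼-map : ∀ {B : Set} (f : A → B) (xs : List A) i → map f xs ‼ i ≡ Maybe.map f (xs ‼ i)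
  ‼-map f []       i       = refl
  ‼-map f (x ∷ xs) zero    = refl
  ‼-map f (x ∷ xs) (suc i) = ‼-map f xs i

  ‼-++ˡ : ∀ {xs ys : List A} {i v} → xs ‼ i ≡ just v → (xs ++ ys) ‼ i ≡ just v
  ‼-++ˡ {x ∷ xs} {i = zero}  e = e
  ‼-++ˡ {x ∷ xs} {i = suc i} e = ‼-++ˡ {xs} e

  ‼-++ʳ : ∀ (xs : List A) {ys} i → (xs ++ ys) ‼ (i + length xs) ≡ ys ‼ i
  ‼-++ʳ []       {ys} i = cong (ys ‼_) (+-identityʳ i)
  ‼-++ʳ (x ∷ xs) i rewrite +-suc i (length xs) = ‼-++ʳ xs i

  ‼-just⇒< : ∀ {xs : List A} {i v} → xs ‼ i ≡ just v → i < length xs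
  ‼-just⇒< {x ∷ xs} {zero}  e = s≤s z≤n
  ‼-just⇒< {x ∷ xs} {suc i} e = s≤s (‼-just⇒< {xs} e)

  <⇒‼-just : ∀ {xs : List A} {i} → i < length xs → ∃ λ v → xs ‼ i ≡ just v
  <⇒‼-just {x ∷ xs} {zero}  _       = x , refl
  <⇒‼-just {x ∷ xs} {suc i} (s≤s p) = <⇒‼-just {xs} p

  ‼-nothing⇒≥ : ∀ {xs : List A} {i} → xs ‼ i ≡ nothing → length xs ≤ i
  ‼-nothing⇒≥ {[]}     e = z≤n
  ‼-nothing⇒≥ {x ∷ xs} {suc i} e = s≤s (‼-nothing⇒≥ {xs} e)

  ≥⇒‼-nothing : ∀ {xs : List A} {i} → length xs ≤ i → xs ‼ i ≡ nothing
  ≥⇒‼-nothing {[]}     _       = refl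
  ≥⇒‼-nothing {x ∷ xs} (s≤s p) = ≥⇒‼-nothing {xs} p

‼-map-nothing : ∀ {A B : Set} (f : A → B) xs {i} → map f xs ‼ i ≡ nothing → xs ‼ i ≡ nothing
‼-map-nothing f xs {i} e =
  ≥⇒‼-nothing {xs = xs} (subst (_≤ i) (length-map f xs) (‼-nothing⇒≥ {xs = map f xs} e))

execute : Instr2 → Config2 → Config2
execute inc₀     (i , a , b)     = suc i , suc a , b
execute inc₁     (i , a , b)     = suc i , a , suc b
execute (dec₀ j) (i , zero , b)  = suc i , zero , b
execute (dec₀ j) (i , suc a , b) = j , a , b
execute (dec₁ j) (i , a , zero)  = suc i , a , zero
execute (dec₁ j) (i , a , suc b) = j , a , b

module _ {N : Machine2} where

  step2⇒execute : ∀ {i c y} → Step2 N (i , c) y → ∃ λ I → N ‼ i ≡ just I × execute I (i , c) ≡ y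
  step2⇒execute (s-inc₀ e)  = _ , e , refl
  step2⇒execute (s-inc₁ e)  = _ , e , refl
  step2⇒execute (s-dec₀z e) = _ , e , refl
  step2⇒execute (s-dec₀s e) = _ , e , refl
  step2⇒execute (s-dec₁z e) = _ , e , refl
  step2⇒execute (s-dec₁s e) = _ , e , refl

  execute⇒step2 : ∀ {i I} c → N ‼ i ≡ just I → Step2 N (i , c) (execute I (i , c))
  execute⇒step2 {I = inc₀}   _            e = s-inc₀ e
  execute⇒step2 {I = inc₁}   _            e = s-inc₁ e
  execute⇒step2 {I = dec₀ j} (zero  , b)  e = s-dec₀z e
  execute⇒step2 {I = dec₀ j} (suc a , b)  e = s-dec₀s e
  execute⇒step2 {I = dec₁ j} (a , zero)   e = s-dec₁z e
  execute⇒step2 {I = dec₁ j} (a , suc b)  e = s-dec₁s e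

  step2-deterministic : Deterministic _≡_ (Step2 N)
  step2-deterministic s t with step2⇒execute s | step2⇒execute t
  ... | _ , e , refl | _ , e′ , refl with just-injective (trans (sym e) e′)
  ... | refl = refl

  step2-halted : ∀ {x y} → Halting2 N x → Step2 N x y → ⊥
  step2-halted h s with step2⇒execute s
  ... | _ , e , _ with trans (sym h) e
  ... | ()

  step2-progress : ∀ x → Halting2 N x ⊎ ∃ (Step2 N x)
  step2-progress (i , c) with N ‼ i in e
  ... | nothing = inj₁ refl
  ... | just I  = inj₂ (_ , execute⇒step2 c e)

bump : Instr2 → Instr2
bump inc₀     = inc₀
bump inc₁     = inc₁
bump (dec₀ j) = dec₀ (suc j)
bump (dec₁ j) = dec₁ (suc j)

prepend : Instr2 → Machine2 → Machine2
prepend I N = I ∷ map bump N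

push : Config2 → Config2
push (i , c) = suc i , c

‼-bump : ∀ N {i I} → N ‼ i ≡ just I → map bump N ‼ i ≡ just (bump I)
‼-bump N {i} e = trans (‼-map bump N i) (map-just e)

module _ {N : Machine2} {I : Instr2} where

  push-step : ∀ {x y} → Step2 N x y → Step2 (prepend I N) (push x) (push y)
  push-step (s-inc₀ e)  = s-inc₀ (‼-bump N e)
  push-step (s-inc₁ e)  = s-inc₁ (‼-bump N e)
  push-step (s-dec₀z e) = s-dec₀z (‼-bump N e)
  push-step (s-dec₀s e) = s-dec₀s (‼-bump N e)
  push-step (s-dec₁z e) = s-dec₁z (‼-bump N e)
  push-step (s-dec₁s e) = s-dec₁s (‼-bump N e)

  prepend-simulation : Simulation (Step2 N) (Halting2 N) (Step2 (prepend I N)) (Halting2 (prepend I N))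
                                  (λ x y → push x ≡ y)
  prepend-simulation = record
    { deterministic    = step2-deterministic
    ; halted-stays     = λ h s → ⊥-elim (step2-halted h s)
    ; progress         = step2-progress
    ; simulate         = λ { s refl → _ , _ , push-step s , ε , refl }
    ; halted-preserved = λ { {i , _} refl h → trans (‼-map bump N i) (map-nothing h) }
    ; halted-reflected = λ { refl h → ‼-map-nothing bump N h }
    }

  prepend-terminates : ∀ {c c′} → Step2 (prepend I N) (0 , c) (1 , c′) →
                       Terminates2 N (0 , c′) ⇔ Terminates2 (prepend I N) (0 , c)
  prepend-terminates s = terminates⇔ prepend-simulation refl (s ◅ ε)

load : ℕ → ℕ → Machine2 → Machine2
load (suc a) b       N = load a b (prepend inc₀ N)
load zero    (suc b) N = load zero b (prepend inc₁ N)
load zero    zero    N = N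

load-terminates : ∀ a b N → Terminates2 N (0 , a , b) ⇔ Terminates2 (load a b N) (0 , 0 , 0)
load-terminates (suc a) b N =
  ⇔-trans (prepend-terminates (s-inc₀ refl)) (load-terminates a b (prepend inc₀ N))
load-terminates zero (suc b) N =
  ⇔-trans (prepend-terminates (s-inc₁ refl)) (load-terminates zero b (prepend inc₁ N))
load-terminates zero zero N = ⇔-refl

d₁ d₂ d₃ d₄ : Fin 4
d₁ = fzero
d₂ = fsuc fzero
d₃ = fsuc (fsuc fzero)
d₄ = fsuc (fsuc (fsuc fzero))

module _ {M : Machine1} where

  step1-divisible : ∀ {i j k c} → M ‼ i ≡ just (j , k) → ∀ x → c ≡ dval k * x →
                    Step1 M (i , c) (j , (dval k + 1) * x)
  step1-divisible {i} {j} {k} e x refl =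
    subst (λ c′ → Step1 M (i , dval k * x) (j , c′)) quotient
          (s-div e (divides x (*-comm (dval k) x)))
    where
    quotient : dval k * x * (dval k + 1) / dval k ≡ (dval k + 1) * x
    quotient = trans (cong (_/ dval k) (reorder (dval k) x)) (m*n/n≡m ((dval k + 1) * x) (dval k))
      where
      reorder : ∀ d x → d * x * (d + 1) ≡ (d + 1) * x * d
      reorder = solve-∀

  step1-double : ∀ {i j c} → M ‼ i ≡ just (j , d₁) → Step1 M (i , c) (j , 2 * c)
  step1-double {c = c} e = step1-divisible e c (sym (*-identityˡ c))

  step1-deterministic : Deterministic _≡_ (Step1 M)
  step1-deterministic (s-halt _)  (s-halt _)    = refl
  step1-deterministic (s-halt l)  (s-div e _)   = ⊥-elim (<⇒≱ (‼-just⇒< {xs = M} e) l)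
  step1-deterministic (s-halt l)  (s-ndiv e _)  = ⊥-elim (<⇒≱ (‼-just⇒< {xs = M} e) l)
  step1-deterministic (s-div e _) (s-halt l)    = ⊥-elim (<⇒≱ (‼-just⇒< {xs = M} e) l)
  step1-deterministic (s-ndiv e _) (s-halt l)   = ⊥-elim (<⇒≱ (‼-just⇒< {xs = M} e) l)
  step1-deterministic (s-div e d) (s-div e′ d′) with just-injective (trans (sym e) e′)
  ... | refl = refl
  step1-deterministic (s-div e d) (s-ndiv e′ d′) with just-injective (trans (sym e) e′)
  ... | refl = ⊥-elim (d′ d)
  step1-deterministic (s-ndiv e d) (s-div e′ d′) with just-injective (trans (sym e) e′)
  ... | refl = ⊥-elim (d d′)
  step1-deterministic (s-ndiv e d) (s-ndiv e′ d′) with just-injective (trans (sym e) e′)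
  ... | refl = refl

enc : ℕ → ℕ → ℕ → ℕ
enc a b g = 4 ^ a * 3 ^ b * 5 ^ g

enc-suc₀ : ∀ a b g → enc (suc a) b g ≡ 4 * enc a b g
enc-suc₀ a b g = law (4 ^ a) (3 ^ b) (5 ^ g)
  where law : ∀ x y z → 4 * x * y * z ≡ 4 * (x * y * z)
        law = solve-∀

enc-suc₁ : ∀ a b g → enc a (suc b) g ≡ 3 * enc a b g
enc-suc₁ a b g = law (4 ^ a) (3 ^ b) (5 ^ g)
  where law : ∀ x y z → x * (3 * y) * z ≡ 3 * (x * y * z)
        law = solve-∀

enc-suc₂ : ∀ a b g → enc a b (suc g) ≡ 5 * enc a b g
enc-suc₂ a b g = law (4 ^ a) (3 ^ b) (5 ^ g)
  where law : ∀ x y z → x * y * (5 * z) ≡ 5 * (x * y * z)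
        law = solve-∀

prime∤-* : ∀ {p m n} → Prime p → p ∤ m → p ∤ n → p ∤ m * n
prime∤-* {m = m} {n} pp p∤m p∤n p∣mn with euclidsLemma m n pp p∣mn
... | inj₁ p∣m = p∤m p∣m
... | inj₂ p∣n = p∤n p∣n

prime∤-^ : ∀ {p m} → Prime p → p ∤ m → ∀ k → p ∤ m ^ k
prime∤-^ pp p∤m zero    p∣1 = ¬prime[1] (subst Prime (∣1⇒≡1 p∣1) pp)
prime∤-^ pp p∤m (suc k) = prime∤-* pp p∤m (prime∤-^ pp p∤m k)

2∤enc : ∀ b g → 2 ∤ enc 0 b g
2∤enc b g =
  prime∤-* 2-prime (prime∤-* 2-prime (from-no (2 ∣? 1)) (prime∤-^ 2-prime (from-no (2 ∣? 3)) b))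
                   (prime∤-^ 2-prime (from-no (2 ∣? 5)) g)
  where 2-prime = from-yes (prime? 2)

4∤enc : ∀ b g → 4 ∤ enc 0 b g
4∤enc b g 4∣c = 2∤enc b g (∣-trans (from-yes (2 ∣? 4)) 4∣c)

3∤enc : ∀ a g → 3 ∤ enc a 0 g
3∤enc a g =
  prime∤-* 3-prime (prime∤-* 3-prime (prime∤-^ 3-prime (from-no (3 ∣? 4)) a) (from-no (3 ∣? 1)))
                   (prime∤-^ 3-prime (from-no (3 ∣? 5)) g)
  where 3-prime = from-yes (prime? 3)

twice : ℕ → ℕ
twice zero    = zero
twice (suc n) = suc (suc (twice n))

twice-mono-≤ : ∀ {m n} → m ≤ n → twice m ≤ twice n
twice-mono-≤ z≤n     = z≤n
twice-mono-≤ (s≤s p) = s≤s (s≤s (twice-mono-≤ p))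

twice-cancel-≤ : ∀ {m n} → twice m ≤ twice n → m ≤ n
twice-cancel-≤ {zero}          _             = z≤n
twice-cancel-≤ {suc m} {suc n} (s≤s (s≤s p)) = s≤s (twice-cancel-≤ p)

module Compile (N : Machine2) where

  n : ℕ
  n = length N

  addr : ℕ → ℕ
  addr i = twice i + n

  -- The jump targets 0 here and in block are junk: those instructions only ever meet
  -- counters that their divisor does not divide.
  detour-target : Instr2 → ℕ
  detour-target (dec₁ j) = addr j
  detour-target _        = 0

  detour : Instr2 → Instr1
  detour I = detour-target I , d₄

  block : ℕ → Instr2 → Instr1 × Instr1
  block i inc₀     = (suc (addr i) , d₁) , (addr (suc i) , d₁)
  block i inc₁     = (suc (addr i) , d₁) , (addr (suc i) , d₂)
  block i (dec₀ j) = (addr j , d₄) , (0 , d₂)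
  block i (dec₁ j) = (i , d₃) , (0 , d₃)

  blocks : ℕ → Machine2 → Machine1
  blocks i []       = []
  blocks i (I ∷ N′) = proj₁ (block i I) ∷ proj₂ (block i I) ∷ blocks (suc i) N′

  compile : Machine1
  compile = map detour N ++ blocks 0 N

  length-blocks : ∀ i N′ → length (blocks i N′) ≡ twice (length N′)
  length-blocks i []       = refl
  length-blocks i (I ∷ N′) = cong (λ m → suc (suc m)) (length-blocks (suc i) N′)

  length-compile : length compile ≡ addr n
  length-compile = begin
    length compile                                ≡⟨ length-++ (map detour N) ⟩
    length (map detour N) + length (blocks 0 N)   ≡⟨ cong₂ _+_ (length-map detour N) (length-blocks 0 N) ⟩
    n + twice n                                   ≡⟨ +-comm n (twice n) ⟩
    addr n                                        ∎
    where open ≡-Reasoning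

  ‼-blocks : ∀ i k {N′ I} → N′ ‼ k ≡ just I →
             blocks i N′ ‼ twice k ≡ just (proj₁ (block (i + k) I)) ×
             blocks i N′ ‼ suc (twice k) ≡ just (proj₂ (block (i + k) I))
  ‼-blocks i zero    {I ∷ N′} refl rewrite +-identityʳ i = refl , refl
  ‼-blocks i (suc k) {_ ∷ N′} e    rewrite +-suc i k     = ‼-blocks (suc i) k {N′} e

  ‼-compile-blocks : ∀ t → compile ‼ (t + n) ≡ blocks 0 N ‼ t
  ‼-compile-blocks t =
    trans (cong (λ m → compile ‼ (t + m)) (sym (length-map detour N))) (‼-++ʳ (map detour N) t)

  ‼-block₀ : ∀ {i I} → N ‼ i ≡ just I → compile ‼ addr i ≡ just (proj₁ (block i I))
  ‼-block₀ {i} e = trans (‼-compile-blocks (twice i)) (proj₁ (‼-blocks 0 i {N} e))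

  ‼-block₁ : ∀ {i I} → N ‼ i ≡ just I → compile ‼ suc (addr i) ≡ just (proj₂ (block i I))
  ‼-block₁ {i} e = trans (‼-compile-blocks (suc (twice i))) (proj₂ (‼-blocks 0 i {N} e))

  ‼-compile-detour : ∀ {i I} → N ‼ i ≡ just I → compile ‼ i ≡ just (detour I)
  ‼-compile-detour {i} e = ‼-++ˡ {xs = map detour N} (trans (‼-map detour N i) (map-just e))

  data _≈_ : Config2 → Config1 → Set where
    encoding : ∀ {i a b c} g → c ≡ enc a b g → (i , a , b) ≈ (addr i , c)

  simulate : ∀ {x y b} → Step2 N x y → x ≈ b →
             ∃₂ λ b₁ b′ → Step1 compile b b₁ × Star (Step1 compile) b₁ b′ × y ≈ b′
  simulate (s-inc₀ {a = a} {b} e) (encoding g refl) =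
    _ , _ , step1-double (‼-block₀ e) , step1-double (‼-block₁ e) ◅ ε
          , encoding g (trans (sym (*-assoc 2 2 (enc a b g))) (sym (enc-suc₀ a b g)))
  simulate (s-inc₁ {a = a} {b} e) (encoding g refl) =
    _ , _ , step1-double (‼-block₀ e) , step1-divisible (‼-block₁ e) (enc a b g) refl ◅ ε
          , encoding g (sym (enc-suc₁ a b g))
  simulate (s-dec₀z {b = b} e) (encoding g refl) =
    _ , _ , s-ndiv (‼-block₀ e) (4∤enc b g) , s-ndiv (‼-block₁ e) (2∤enc b g) ◅ ε
          , encoding g refl
  simulate (s-dec₀s {a = a} {b} e) (encoding g refl) =
    _ , _ , step1-divisible (‼-block₀ e) (enc a b g) (enc-suc₀ a b g) , ε
          , encoding (suc g) (sym (enc-suc₂ a b g))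
  simulate (s-dec₁z {a = a} e) (encoding g refl) =
    _ , _ , s-ndiv (‼-block₀ e) (3∤enc a g) , s-ndiv (‼-block₁ e) (3∤enc a g) ◅ ε
          , encoding g refl
  simulate (s-dec₁s {a = a} {b} e) (encoding g refl) =
    _ , _ , step1-divisible (‼-block₀ e) (enc a b g) (enc-suc₁ a b g)
          , step1-divisible (‼-compile-detour e) (enc a b g) refl ◅ ε
          , encoding (suc g) (sym (enc-suc₂ a b g))

  compile-simulation : Simulation (Step2 N) (Halting2 N) (Step1 compile) (Halting1 compile) _≈_
  compile-simulation = record
    { deterministic    = step1-deterministic
    ; halted-stays     = λ h s → sym (step1-deterministic (s-halt h) s)
    ; progress         = step2-progress
    ; simulate         = simulate
    ; halted-preserved = λ { {i , _} (encoding _ _) h →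
        subst (_≤ addr i) (sym length-compile) (+-monoˡ-≤ n (twice-mono-≤ (‼-nothing⇒≥ {xs = N} h))) }
    ; halted-reflected = λ { {i , _} (encoding _ _) h →
        ≥⇒‼-nothing {xs = N} (twice-cancel-≤ (+-cancelʳ-≤ n _ _ (subst (_≤ addr i) length-compile h))) }
    }

  skip-detours : ∀ t → t ≤ n → Star (Step1 compile) (0 , 1) (t , 1)
  skip-detours zero    _   = ε
  skip-detours (suc t) t<n =
    skip-detours t (<⇒≤ t<n) ◅◅
    s-ndiv (‼-compile-detour (proj₂ (<⇒‼-just {xs = N} t<n))) (from-no (4 ∣? 1)) ◅ ε

  compile-terminates : Terminates2 N (0 , 0 , 0) ⇔ Terminates1 compile (0 , 1)
  compile-terminates = terminates⇔ compile-simulation (encoding 0 refl) (skip-detours n ≤-refl)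

open Compile using (compile; compile-terminates)

lemma3p7 : Σ (Machine2 → ℕ → ℕ → Machine1) λ f →
    (N : Machine2) (a b : ℕ) →
    Terminates2 N (0 , (a , b)) ⇔ Terminates1 (f N a b) (0 , 1)
lemma3p7 = (λ N a b → compile (load a b N)) ,
           (λ N a b → ⇔-trans (load-terminates a b N) (compile-terminates (load a b N)))
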